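{- Let $d$ be a defined $n$-ary operator, $e_1,\ldots,e_n$ expressions, and $i\in\{1,\ldots,n\}$ such that $e_i$ is rigid. Let $\mathcal{M}$ be a Kripke model, $w$ a state of $\mathcal{M}$, and $x$ a rigid variable not occurring free in any $e_j$. Then $[\![d(e_1,\ldots,e_n)]\!]^\mathcal{M}_w = [\![d(e_1,\ldots,e_{i-1},x,e_{i+1},\ldots,e_n)]\!]^{\mathcal{M}'}_w$, where $\mathcal{M}'$ agrees with $\mathcal{M}$ except that its rigid valuation $\xi'$ is like $\xi$ but assigns to $x$ the value $[\![e_i]\!]^\mathcal{M}_w$.
   Context: Syntax of FOML: fix pairwise disjoint non-empty denumerable sets $\mathcal{X}$ (rigid variables), $\mathcal{V}$ (flexible variables) and $\mathcal{O}$ (operator symbols with arities). Expressions: $e ::= x \mid v \mid op(e,\ldots,e) \mid e = e \mid \mathrm{FALSE} \mid e \Rightarrow e \mid \forall x : e \mid \nabla e$, extended with applications $d(e_1,\ldots,e_n)$ of defined operators. A definition has the form $d(x_1,\ldots,x_n)\triangleq e$ with $d$ a fresh symbol, $x_1,\ldots,x_n$ pairwise distinct rigid variables, and $e$ an expression (possibly using previously defined operators) whose free rigid variables are among $x_1,\ldots,x_n$. An expression is rigid iff (with defined operators fully expanded) it contains no flexible variable and no subexpression of the form $\nabla e$. Semantics: a Kripke model is $\mathcal{M}=(\mathcal{I},\xi,\mathcal{W},R,\zeta,\nabla_\mathcal{M})$: $\mathcal{I}$ a first-order interpretation with universe $|\mathcal{I}|$ containing distinct values $\mathsf{tt},\mathsf{ff}$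 and $\mathcal{I}(op):|\mathcal{I}|^n\to|\mathcal{I}|$ for $n$-ary $op\in\mathcal{O}$; $\xi:\mathcal{X}\to|\mathcal{I}|$; $\mathcal{W}$ a non-empty set of states; $R\subseteq\mathcal{W}\times\mathcal{W}$; $\zeta:\mathcal{V}\times\mathcal{W}\to|\mathcal{I}|$; $\nabla_\mathcal{M}:2^{|\mathcal{I}|}\to|\mathcal{I}|$ with $\nabla_\mathcal{M}(S)=\mathsf{tt}$ iff $S\subseteq\{\mathsf{tt}\}$. Values $[\![e]\!]^\mathcal{M}_w$: $\xi(x)$; $\zeta(v,w)$; $\mathcal{I}(op)$ applied to argument values; $e_1=e_2$ gives $\mathsf{tt}$ if equal values else $\mathsf{ff}$; $\mathrm{FALSE}$ gives $\mathsf{ff}$; $\varphi\Rightarrow\psi$ gives $\mathsf{tt}$ iff $[\![\varphi]\!]_w\neq\mathsf{tt}$ or $[\![\psi]\!]_w=\mathsf{tt}$, else $\mathsf{ff}$; $\forall x:\varphi$ gives $\mathsf{tt}$ iff $\varphi$ has value $\mathsf{tt}$ at $w$ in every model differing from $\mathcal{M}$ only in $\xi(x)$, else $\mathsf{ff}$; $\nabla\varphi$ gives $\nabla_\mathcal{M}(\{[\![\varphi]\!]_{w'}:(w,w')\in R\})$; and for $d(x_1,\ldots,x_n)\triangleq e$, $[\![d(e_1,\ldots,e_n)]\!]^\mathcal{M}_w = [\![e[e_1/x_1,\ldots,e_n/x_n]]\!]^\mathcal{M}_w$ (capture-avoiding substitution). -}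

module Defs where

open import Level using (0ℓ)
open import Data.Nat using (ℕ; zero; suc; _⊔_; _≟_)
open import Data.Fin using (Fin)
open import Data.Vec using (Vec; []; _∷_; lookup)
open import Data.List using (List; []; _∷_)
open import Data.Product using (Σ; _×_; _,_)
open import Data.Sum using (_⊎_)
open import Data.Empty using (⊥)
open import Relation.Nullary using (¬_; Dec; yes; no)
open import Relation.Binary.PropositionalEquality using (_≡_; _≢_)
open import Function.Bundles using (_⇔_)
open import Axiom.ExcludedMiddle using (ExcludedMiddle)

-- Operator symbols:
-- an operator symbol is a pair (arity k, name nm), so there are
-- denumerably many symbols of every arity.

-- An application d(e₁,…,eₙ) of d(x₁,…,xₙ) ≜ b is represented by
-- 'dapp n (x₁ ∷ … ∷ xₙ) b (e₁ ∷ … ∷ eₙ)' (the symbol name of d plays no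
-- semantic role; the definition is identified by its parameters and body).
data Expr : Set where
  rvar  : ℕ → Expr
  fvar  : ℕ → Expr
  op    : (k nm : ℕ) → Vec Expr k → Expr
  _≐_   : Expr → Expr → Expr
  FALSE : Expr
  _⇒_   : Expr → Expr → Expr
  all   : ℕ → Expr → Expr
  nabla : Expr → Expr
  dapp  : (n : ℕ) → Vec ℕ n → Expr → Vec Expr n → Expr

data Core : Set where
  rvar  : ℕ → Core
  fvar  : ℕ → Core
  op    : (k nm : ℕ) → Vec Core k → Core
  _≐_   : Core → Core → Core
  FALSE : Core
  _⇒_   : Core → Core → Core
  all   : ℕ → Core → Core
  nabla : Core → Core

mutual
  data FreeIn (x : ℕ) : Expr → Set where
    f-var  : FreeIn x (rvar x)
    f-op   : ∀ {k nm es} → FreeInV x es → FreeIn x (op k nm es)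
    f-eqˡ  : ∀ {a b} → FreeIn x a → FreeIn x (a ≐ b)
    f-eqʳ  : ∀ {a b} → FreeIn x b → FreeIn x (a ≐ b)
    f-impˡ : ∀ {a b} → FreeIn x a → FreeIn x (a ⇒ b)
    f-impʳ : ∀ {a b} → FreeIn x b → FreeIn x (a ⇒ b)
    f-all  : ∀ {y a} → y ≢ x → FreeIn x a → FreeIn x (all y a)
    f-nab  : ∀ {a} → FreeIn x a → FreeIn x (nabla a)
    f-body : ∀ {n ps b es} → FreeIn x b → (∀ (k : Fin n) → lookup ps k ≢ x)
             → FreeIn x (dapp n ps b es)
    f-arg  : ∀ {n ps b es} → FreeInV x es → FreeIn x (dapp n ps b es)

  data FreeInV (x : ℕ) : ∀ {k} → Vec Expr k → Set where
    here  : ∀ {k e} {es : Vec Expr k} → FreeIn x e → FreeInV x (e ∷ es)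
    there : ∀ {k e} {es : Vec Expr k} → FreeInV x es → FreeInV x (e ∷ es)

Distinct : ∀ {n} → Vec ℕ n → Set
Distinct {n} ps = ∀ (i j : Fin n) → lookup ps i ≡ lookup ps j → i ≡ j

ClosedOver : ∀ {n} → Vec ℕ n → Expr → Set
ClosedOver {n} ps b = ∀ y → FreeIn y b → Σ (Fin n) λ k → lookup ps k ≡ y

mutual
  data WF : Expr → Set where
    wf-rvar : ∀ {x} → WF (rvar x)
    wf-fvar : ∀ {v} → WF (fvar v)
    wf-op   : ∀ {k nm es} → WFV es → WF (op k nm es)
    wf-eq   : ∀ {a b} → WF a → WF b → WF (a ≐ b)
    wf-F    : WF FALSE
    wf-imp  : ∀ {a b} → WF a → WF b → WF (a ⇒ b)
    wf-all  : ∀ {x a} → WF a → WF (all x a)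
    wf-nab  : ∀ {a} → WF a → WF (nabla a)
    wf-dapp : ∀ {n ps b es} → Distinct ps → ClosedOver ps b → WF b → WFV es
              → WF (dapp n ps b es)

  data WFV : ∀ {k} → Vec Expr k → Set where
    []  : WFV []
    _∷_ : ∀ {k e} {es : Vec Expr k} → WF e → WFV es → WFV (e ∷ es)

record Definition : Set where
  field
    arity    : ℕ
    params   : Vec ℕ arity
    body     : Expr
    distinct : Distinct params
    closed   : ClosedOver params body
    body-wf  : WF body

open Definition public

_⟨_⟩ : (d : Definition) → Vec Expr (arity d) → Expr
d ⟨ es ⟩ = dapp (arity d) (params d) (body d) es

Sub : Set
Sub = List (ℕ × Core)

lookupSub : Sub → ℕ → Core
lookupSub []            x = rvar x
lookupSub ((y , e) ∷ σ) x with y ≟ x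
... | yes _ = e
... | no  _ = lookupSub σ x

mutual
  maxVar : Core → ℕ
  maxVar (rvar x)     = x
  maxVar (fvar _)     = 0
  maxVar (op k nm es) = maxVarV es
  maxVar (a ≐ b)      = maxVar a ⊔ maxVar b
  maxVar FALSE        = 0
  maxVar (a ⇒ b)      = maxVar a ⊔ maxVar b
  maxVar (all x a)    = x ⊔ maxVar a
  maxVar (nabla a)    = maxVar a

  maxVarV : ∀ {k} → Vec Core k → ℕ
  maxVarV []       = 0
  maxVarV (e ∷ es) = maxVar e ⊔ maxVarV es

maxSub : Sub → ℕ
maxSub []            = 0
maxSub ((y , e) ∷ σ) = y ⊔ maxVar e ⊔ maxSub σ

fresh : Core → Sub → ℕ
fresh a σ = suc (maxVar a ⊔ maxSub σ)

mutual
  subst : Core → Sub → Core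
  subst (rvar x)     σ = lookupSub σ x
  subst (fvar v)     σ = fvar v
  subst (op k nm es) σ = op k nm (substV es σ)
  subst (a ≐ b)      σ = subst a σ ≐ subst b σ
  subst FALSE        σ = FALSE
  subst (a ⇒ b)      σ = subst a σ ⇒ subst b σ
  subst (all x a)    σ = all y (subst a ((x , rvar y) ∷ σ))
    where y = fresh (all x a) σ
  subst (nabla a)    σ = nabla (subst a σ)

  substV : ∀ {k} → Vec Core k → Sub → Vec Core k
  substV []       σ = []
  substV (e ∷ es) σ = subst e σ ∷ substV es σ

zipSub : ∀ {n} → Vec ℕ n → Vec Core n → Sub
zipSub []       []       = []
zipSub (x ∷ xs) (e ∷ es) = (x , e) ∷ zipSub xs es

mutual
  expand : Expr → Core
  expand (rvar x)          = rvar x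
  expand (fvar v)          = fvar v
  expand (op k nm es)      = op k nm (expandV es)
  expand (a ≐ b)           = expand a ≐ expand b
  expand FALSE             = FALSE
  expand (a ⇒ b)           = expand a ⇒ expand b
  expand (all x a)         = all x (expand a)
  expand (nabla a)         = nabla (expand a)
  expand (dapp n ps b es)  = subst (expand b) (zipSub ps (expandV es))

  expandV : ∀ {k} → Vec Expr k → Vec Core k
  expandV []       = []
  expandV (e ∷ es) = expand e ∷ expandV es

mutual
  data RigidC : Core → Set where
    r-rvar : ∀ {x} → RigidC (rvar x)
    r-op   : ∀ {k nm es} → RigidV es → RigidC (op k nm es)
    r-eq   : ∀ {a b} → RigidC a → RigidC b → RigidC (a ≐ b)
    r-F    : RigidC FALSE
    r-imp  : ∀ {a b} → RigidC a → RigidC b → RigidC (a ⇒ b)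
    r-all  : ∀ {x a} → RigidC a → RigidC (all x a)

  data RigidV : ∀ {k} → Vec Core k → Set where
    []  : RigidV []
    _∷_ : ∀ {k e} {es : Vec Core k} → RigidC e → RigidV es → RigidV (e ∷ es)

Rigid : Expr → Set
Rigid e = RigidC (expand e)

-- Kripke models.  Subsets of the universe are predicates U → Set;
-- ∇_M is required to be extensional (it is a function on 2^|I|).

record Model : Set₁ where
  field
    U       : Set
    tt ff   : U
    tt≢ff   : tt ≢ ff
    I       : (k nm : ℕ) → Vec U k → U
    ξ       : ℕ → U
    W       : Set
    w₀      : W
    R       : W → W → Set
    ζ       : ℕ → W → U
    ∇M      : (U → Set) → U
    ∇M-ext  : ∀ (S T : U → Set) → (∀ a → S a ⇔ T a) → ∇M S ≡ ∇M T
    ∇M-tt   : ∀ (S : U → Set) → (∇M S ≡ tt) ⇔ (∀ a → S a → a ≡ tt)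

open Model public

update : {A : Set} → (ℕ → A) → ℕ → A → ℕ → A
update f x a y with x ≟ y
... | yes _ = a
... | no  _ = f y

_[_↦_] : (M : Model) → ℕ → U M → Model
M [ x ↦ a ] = record M { ξ = update (ξ M) x a }

module Semantics (lem : ExcludedMiddle 0ℓ) where

  truth : ∀ (M : Model) (P : Set) → U M
  truth M P with lem {P}
  ... | yes _ = tt M
  ... | no  _ = ff M

  mutual
    evalC : (M : Model) → Core → W M → U M
    evalC M (rvar x)     w = ξ M x
    evalC M (fvar v)     w = ζ M v w
    evalC M (op k nm es) w = I M k nm (evalV M es w)
    evalC M (a ≐ b)      w = truth M (evalC M a w ≡ evalC M b w)
    evalC M FALSE        w = ff M
    evalC M (a ⇒ b)      w =
      truth M (¬ (evalC M a w ≡ tt M) ⊎ evalC M b w ≡ tt M)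
    evalC M (all x a)    w =
      truth M (∀ (u : U M) → evalC (M [ x ↦ u ]) a w ≡ tt M)
    evalC M (nabla a)    w =
      ∇M M (λ u → Σ (W M) λ w' → R M w w' × evalC M a w' ≡ u)

    evalV : (M : Model) → ∀ {k} → Vec Core k → W M → Vec (U M) k
    evalV M []       w = []
    evalV M (e ∷ es) w = evalC M e w ∷ evalV M es w

  ⟦_⟧ : Expr → (M : Model) → W M → U M
  ⟦ e ⟧ M w = evalC M (expand e) w

module Submission where

-- The value of d(e₁,…,eₙ) is the value of body[e₁/x₁,…,eₙ/xₙ], and the
-- file proves a semantic substitution lemma: the value of a[σ] under a
-- valuation f equals that of a[σ′] under g as soon as σ(y) under f and
-- σ′(y) under g have equal values, at every state, for all y free in a.
-- Since the body of a definition has only parameters free (after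
-- expansion, which creates no free variables), it suffices that the
-- corresponding arguments of the two applications agree at every state.
-- For the rigid argument eᵢ this holds because rigid expressions have
-- the same value at all states, so eᵢ is everywhere worth ξ′(x); for the
-- other arguments it is the coincidence lemma, since x is not free in
-- them.

open import Defs
open import Level using (0ℓ)
open import Data.Nat using (ℕ; _⊔_; _≟_; _≤_)
open import Data.Nat.Properties
  using (≤-refl; ≤-trans; ≤-reflexive; m≤m⊔n; m≤n⊔m; ⊔-monoˡ-≤; ⊔-monoʳ-≤; n≮n)
open import Data.Fin using (Fin; zero; suc)
open import Data.Fin.Properties using () renaming (_≟_ to _≟ᶠ_)
open import Data.Vec using (Vec; lookup; _[_]≔_; []; _∷_)
open import Data.Vec.Properties using (lookup∘update; lookup∘update′)
open import Data.List using ([]; _∷_)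
open import Data.Product using (Σ; _×_; _,_)
open import Data.Sum using (_⊎_; inj₁; inj₂)
open import Data.Empty using (⊥-elim)
open import Function using (id; _∘_)
open import Relation.Nullary using (¬_; yes; no)
open import Relation.Binary.PropositionalEquality
  using (_≡_; _≢_; refl; sym; trans; cong; cong₂; module ≡-Reasoning)
open import Function.Bundles using (mk⇔)
open import Axiom.ExcludedMiddle using (ExcludedMiddle)

update-same : {A : Set} (f : ℕ → A) (x : ℕ) (a : A) → update f x a x ≡ a
update-same f x a with x ≟ x
... | yes _   = refl
... | no x≢x = ⊥-elim (x≢x refl)

update-other : {A : Set} (f : ℕ → A) (x : ℕ) (a : A) (y : ℕ) → x ≢ y
             → update f x a y ≡ f y
update-other f x a y x≢y with x ≟ y
... | yes x≡y = ⊥-elim (x≢y x≡y)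
... | no _    = refl

update-agree : {A : Set} (f g : ℕ → A) (z : ℕ) (a : A) (y : ℕ)
             → (z ≢ y → f y ≡ g y) → update f z a y ≡ update g z a y
update-agree f g z a y agree with z ≟ y
... | yes _   = refl
... | no z≢y = agree z≢y

mutual
  data FreeC (x : ℕ) : Core → Set where
    c-var  : FreeC x (rvar x)
    c-op   : ∀ {k nm es} → FreeCV x es → FreeC x (op k nm es)
    c-eqˡ  : ∀ {a b} → FreeC x a → FreeC x (a ≐ b)
    c-eqʳ  : ∀ {a b} → FreeC x b → FreeC x (a ≐ b)
    c-impˡ : ∀ {a b} → FreeC x a → FreeC x (a ⇒ b)
    c-impʳ : ∀ {a b} → FreeC x b → FreeC x (a ⇒ b)
    c-all  : ∀ {y a} → y ≢ x → FreeC x a → FreeC x (all y a)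
    c-nab  : ∀ {a} → FreeC x a → FreeC x (nabla a)

  data FreeCV (x : ℕ) : ∀ {k} → Vec Core k → Set where
    here  : ∀ {k e} {es : Vec Core k} → FreeC x e → FreeCV x (e ∷ es)
    there : ∀ {k e} {es : Vec Core k} → FreeCV x es → FreeCV x (e ∷ es)

free-rvar : ∀ {y z} → FreeC y (rvar z) → z ≡ y
free-rvar c-var = refl

-- maxVar bounds the free variables; this is what makes 'fresh' fresh.
mutual
  free-≤-maxVar : ∀ {y a} → FreeC y a → y ≤ maxVar a
  free-≤-maxVar c-var         = ≤-refl
  free-≤-maxVar (c-op fv)     = free-≤-maxVarV fv
  free-≤-maxVar (c-eqˡ fa)    = ≤-trans (free-≤-maxVar fa) (m≤m⊔n _ _)
  free-≤-maxVar (c-eqʳ fb)    = ≤-trans (free-≤-maxVar fb) (m≤n⊔m _ _)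
  free-≤-maxVar (c-impˡ fa)   = ≤-trans (free-≤-maxVar fa) (m≤m⊔n _ _)
  free-≤-maxVar (c-impʳ fb)   = ≤-trans (free-≤-maxVar fb) (m≤n⊔m _ _)
  free-≤-maxVar (c-all _ fa)  = ≤-trans (free-≤-maxVar fa) (m≤n⊔m _ _)
  free-≤-maxVar (c-nab fa)    = free-≤-maxVar fa

  free-≤-maxVarV : ∀ {y k} {es : Vec Core k} → FreeCV y es → y ≤ maxVarV es
  free-≤-maxVarV (here fe)   = ≤-trans (free-≤-maxVar fe) (m≤m⊔n _ _)
  free-≤-maxVarV (there fes) = ≤-trans (free-≤-maxVarV fes) (m≤n⊔m _ _)

free-lookupSub-≤ : ∀ σ t {y} → FreeC y (lookupSub σ t) → y ≤ t ⊔ maxSub σ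
free-lookupSub-≤ []            t c-var = m≤m⊔n t 0
free-lookupSub-≤ ((z , e) ∷ σ) t fy with z ≟ t
... | yes _ = ≤-trans (free-≤-maxVar fy)
                (≤-trans (m≤n⊔m z (maxVar e))
                  (≤-trans (m≤m⊔n _ (maxSub σ)) (m≤n⊔m t _)))
... | no _  = ≤-trans (free-lookupSub-≤ σ t fy)
                (⊔-monoʳ-≤ t (m≤n⊔m (z ⊔ maxVar e) (maxSub σ)))

fresh-not-free : ∀ z a σ t y → FreeC t (all z a) → FreeC y (lookupSub σ t)
               → fresh (all z a) σ ≢ y
fresh-not-free z a σ t y ft fy fresh≡y =
  n≮n _ (≤-trans (≤-reflexive fresh≡y)
          (≤-trans (free-lookupSub-≤ σ t fy) (⊔-monoˡ-≤ (maxSub σ) (free-≤-maxVar ft))))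

free-under-binder : ∀ z y₁ σ t {y} → y₁ ≢ y
                  → FreeC y (lookupSub ((z , rvar y₁) ∷ σ) t)
                  → z ≢ t × FreeC y (lookupSub σ t)
free-under-binder z y₁ σ t y₁≢y fy with z ≟ t
... | yes _   = ⊥-elim (y₁≢y (free-rvar fy))
... | no z≢t = z≢t , fy

mutual
  free-subst : ∀ a σ {y} → FreeC y (subst a σ)
             → Σ ℕ λ t → FreeC t a × FreeC y (lookupSub σ t)
  free-subst (rvar x) σ fy = x , c-var , fy
  free-subst (op k nm es) σ (c-op fv) with free-substV es σ fv
  ... | t , ft , fy = t , c-op ft , fy
  free-subst (a ≐ b) σ (c-eqˡ fa) with free-subst a σ fa
  ... | t , ft , fy = t , c-eqˡ ft , fy
  free-subst (a ≐ b) σ (c-eqʳ fb) with free-subst b σ fb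
  ... | t , ft , fy = t , c-eqʳ ft , fy
  free-subst (a ⇒ b) σ (c-impˡ fa) with free-subst a σ fa
  ... | t , ft , fy = t , c-impˡ ft , fy
  free-subst (a ⇒ b) σ (c-impʳ fb) with free-subst b σ fb
  ... | t , ft , fy = t , c-impʳ ft , fy
  free-subst (all z a) σ (c-all y₁≢y fa)
    with free-subst a ((z , rvar (fresh (all z a) σ)) ∷ σ) fa
  ... | t , ft , fy with free-under-binder z (fresh (all z a) σ) σ t y₁≢y fy
  ...   | z≢t , fy′ = t , c-all z≢t ft , fy′
  free-subst (nabla a) σ (c-nab fa) with free-subst a σ fa
  ... | t , ft , fy = t , c-nab ft , fy

  free-substV : ∀ {k} (es : Vec Core k) σ {y} → FreeCV y (substV es σ)
              → Σ ℕ λ t → FreeCV t es × FreeC y (lookupSub σ t)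
  free-substV (e ∷ es) σ (here fe) with free-subst e σ fe
  ... | t , ft , fy = t , here ft , fy
  free-substV (e ∷ es) σ (there fes) with free-substV es σ fes
  ... | t , ft , fy = t , there ft , fy

free-zipSub : ∀ {n} (ps : Vec ℕ n) (as : Vec Core n) t {y}
            → FreeC y (lookupSub (zipSub ps as) t)
            → (y ≡ t × (∀ k → lookup ps k ≢ t)) ⊎ FreeCV y as
free-zipSub []       []       t fy = inj₁ (sym (free-rvar fy) , λ ())
free-zipSub (p ∷ ps) (a ∷ as) t fy with p ≟ t
... | yes _ = inj₂ (here fy)
... | no p≢t with free-zipSub ps as t fy
...   | inj₁ (y≡t , ps≢t) = inj₁ (y≡t , λ { zero → p≢t ; (suc k) → ps≢t k })
...   | inj₂ fas          = inj₂ (there fas)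

mutual
  free-expand : ∀ e {y} → FreeC y (expand e) → FreeIn y e
  free-expand (rvar x)     c-var          = f-var
  free-expand (op k nm es) (c-op fv)      = f-op (free-expandV es fv)
  free-expand (a ≐ b)      (c-eqˡ fa)     = f-eqˡ (free-expand a fa)
  free-expand (a ≐ b)      (c-eqʳ fb)     = f-eqʳ (free-expand b fb)
  free-expand (a ⇒ b)      (c-impˡ fa)    = f-impˡ (free-expand a fa)
  free-expand (a ⇒ b)      (c-impʳ fb)    = f-impʳ (free-expand b fb)
  free-expand (all x a)    (c-all x≢y fa) = f-all x≢y (free-expand a fa)
  free-expand (nabla a)    (c-nab fa)     = f-nab (free-expand a fa)
  free-expand (dapp n ps b es) fy
    with free-subst (expand b) (zipSub ps (expandV es)) fy
  ... | t , ft , fy′ with free-zipSub ps (expandV es) t fy′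
  ...   | inj₁ (refl , ps≢t) = f-body (free-expand b ft) ps≢t
  ...   | inj₂ fes           = f-arg (free-expandV es fes)

  free-expandV : ∀ {k} (es : Vec Expr k) {y} → FreeCV y (expandV es) → FreeInV y es
  free-expandV (e ∷ es) (here fe)   = here (free-expand e fe)
  free-expandV (e ∷ es) (there fes) = there (free-expandV es fes)

lookupSub-hit : ∀ {p y a σ} → p ≡ y → lookupSub ((p , a) ∷ σ) y ≡ a
lookupSub-hit {p} {y} p≡y with p ≟ y
... | yes _   = refl
... | no p≢y = ⊥-elim (p≢y p≡y)

lookupSub-miss : ∀ {p y a σ} → p ≢ y → lookupSub ((p , a) ∷ σ) y ≡ lookupSub σ y
lookupSub-miss {p} {y} p≢y with p ≟ y
... | yes p≡y = ⊥-elim (p≢y p≡y)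
... | no _    = refl

zipSub-parameter : ∀ {n} (ps : Vec ℕ n) y → (Σ (Fin n) λ k → lookup ps k ≡ y)
                 → Σ (Fin n) λ k → ∀ (as : Vec Core n) → lookupSub (zipSub ps as) y ≡ lookup as k
zipSub-parameter (p ∷ ps) y param with p ≟ y
... | yes p≡y = zero , λ { (a ∷ as) → lookupSub-hit p≡y }
... | no p≢y with param
...   | zero  , p≡y = ⊥-elim (p≢y p≡y)
...   | suc k , pk≡y with zipSub-parameter ps y (k , pk≡y)
...     | k′ , picks = suc k′ , λ { (a ∷ as) → trans (lookupSub-miss p≢y) (picks as) }

lookup-expandV : ∀ {n} (es : Vec Expr n) k → lookup (expandV es) k ≡ expand (lookup es k)
lookup-expandV (e ∷ es) zero    = refl
lookup-expandV (e ∷ es) (suc k) = lookup-expandV es k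

module ModelSemantics (lem : ExcludedMiddle 0ℓ) (M : Model) where
  open Semantics lem
  open ≡-Reasoning

  Mξ : (ℕ → U M) → Model
  Mξ f = record M { ξ = f }

  truth-cong : ∀ f g {P Q : Set} → (P → Q) → (Q → P) → truth (Mξ f) P ≡ truth (Mξ g) Q
  truth-cong f g {P} {Q} P→Q Q→P with lem {P} | lem {Q}
  ... | yes _  | yes _  = refl
  ... | yes p  | no ¬q = ⊥-elim (¬q (P→Q p))
  ... | no ¬p | yes q  = ⊥-elim (¬p (Q→P q))
  ... | no _   | no _   = refl

  ≐-cong : ∀ f g {a a′ b b′ : U M} → a ≡ a′ → b ≡ b′
         → truth (Mξ f) (a ≡ b) ≡ truth (Mξ g) (a′ ≡ b′)
  ≐-cong f g refl refl = truth-cong f g id id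

  ⇒-cong : ∀ f g {a a′ b b′ : U M} → a ≡ a′ → b ≡ b′
         → truth (Mξ f) (¬ (a ≡ tt M) ⊎ b ≡ tt M) ≡ truth (Mξ g) (¬ (a′ ≡ tt M) ⊎ b′ ≡ tt M)
  ⇒-cong f g refl refl = truth-cong f g id id

  ∀-cong : ∀ f g {F G : U M → U M} → (∀ v → F v ≡ G v)
         → truth (Mξ f) (∀ v → F v ≡ tt M) ≡ truth (Mξ g) (∀ v → G v ≡ tt M)
  ∀-cong f g F≗G =
    truth-cong f g (λ H v → trans (sym (F≗G v)) (H v)) (λ H v → trans (F≗G v) (H v))

  ∇-cong : ∀ {w} {F G : W M → U M} → (∀ w′ → F w′ ≡ G w′)
         → ∇M M (λ a → Σ (W M) λ w′ → R M w w′ × F w′ ≡ a)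
           ≡ ∇M M (λ a → Σ (W M) λ w′ → R M w w′ × G w′ ≡ a)
  ∇-cong F≗G = ∇M-ext M _ _ λ a →
    mk⇔ (λ { (w′ , r , Fw′≡a) → w′ , r , trans (sym (F≗G w′)) Fw′≡a })
        (λ { (w′ , r , Gw′≡a) → w′ , r , trans (F≗G w′) Gw′≡a })

  mutual
    coincidence : ∀ a f g → (∀ y → FreeC y a → f y ≡ g y)
                → ∀ u → evalC (Mξ f) a u ≡ evalC (Mξ g) a u
    coincidence (rvar x)     f g agree u = agree x c-var
    coincidence (fvar v)     f g agree u = refl
    coincidence (op k nm es) f g agree u =
      cong (I M k nm) (coincidenceV es f g (λ y → agree y ∘ c-op) u)
    coincidence (a ≐ b)      f g agree u =
      ≐-cong f g (coincidence a f g (λ y → agree y ∘ c-eqˡ) u)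
                 (coincidence b f g (λ y → agree y ∘ c-eqʳ) u)
    coincidence FALSE        f g agree u = refl
    coincidence (a ⇒ b)      f g agree u =
      ⇒-cong f g (coincidence a f g (λ y → agree y ∘ c-impˡ) u)
                 (coincidence b f g (λ y → agree y ∘ c-impʳ) u)
    coincidence (all z a)    f g agree u = ∀-cong f g λ v →
      coincidence a (update f z v) (update g z v)
        (λ y fy → update-agree f g z v y (λ z≢y → agree y (c-all z≢y fy))) u
    coincidence (nabla a)    f g agree u =
      ∇-cong (coincidence a f g (λ y → agree y ∘ c-nab))

    coincidenceV : ∀ {k} (es : Vec Core k) f g → (∀ y → FreeCV y es → f y ≡ g y)
                 → ∀ u → evalV (Mξ f) es u ≡ evalV (Mξ g) es u
    coincidenceV []       f g agree u = refl
    coincidenceV (e ∷ es) f g agree u =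
      cong₂ _∷_ (coincidence e f g (λ y → agree y ∘ here) u)
                (coincidenceV es f g (λ y → agree y ∘ there) u)

  update-irrelevant : ∀ e f x v → ¬ FreeIn x e → ∀ u → ⟦ e ⟧ (Mξ f) u ≡ ⟦ e ⟧ (Mξ (update f x v)) u
  update-irrelevant e f x v x∉e =
    coincidence (expand e) f (update f x v)
      (λ y fy → sym (update-other f x v y λ { refl → x∉e (free-expand e fy) }))

  SubstAgree : Core → Sub → Sub → (ℕ → U M) → (ℕ → U M) → Set
  SubstAgree a σ σ′ f g =
    ∀ y → FreeC y a → ∀ u → evalC (Mξ f) (lookupSub σ y) u ≡ evalC (Mξ g) (lookupSub σ′ y) u

  binder-agree : ∀ z a σ σ′ f g v → SubstAgree (all z a) σ σ′ f g
               → let y₁ = fresh (all z a) σ ; y₂ = fresh (all z a) σ′ in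
                 SubstAgree a ((z , rvar y₁) ∷ σ) ((z , rvar y₂) ∷ σ′)
                              (update f y₁ v) (update g y₂ v)
  binder-agree z a σ σ′ f g v agree t ft u with z ≟ t
  ... | yes _   = trans (update-same f y₁ v) (sym (update-same g y₂ v))
    where y₁ = fresh (all z a) σ
          y₂ = fresh (all z a) σ′
  ... | no z≢t = begin
    evalC (Mξ (update f y₁ v)) (lookupSub σ t) u
      ≡⟨ coincidence (lookupSub σ t) _ f
           (λ y fy → update-other f y₁ v y (fresh-not-free z a σ t y ft′ fy)) u ⟩
    evalC (Mξ f) (lookupSub σ t) u
      ≡⟨ agree t ft′ u ⟩
    evalC (Mξ g) (lookupSub σ′ t) u
      ≡⟨ coincidence (lookupSub σ′ t) g _
           (λ y fy → sym (update-other g y₂ v y (fresh-not-free z a σ′ t y ft′ fy))) u ⟩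
    evalC (Mξ (update g y₂ v)) (lookupSub σ′ t) u ∎
    where y₁ = fresh (all z a) σ
          y₂ = fresh (all z a) σ′
          ft′ = c-all z≢t ft

  mutual
    substitution : ∀ a σ σ′ f g → SubstAgree a σ σ′ f g
                 → ∀ u → evalC (Mξ f) (subst a σ) u ≡ evalC (Mξ g) (subst a σ′) u
    substitution (rvar x)     σ σ′ f g agree u = agree x c-var u
    substitution (fvar v)     σ σ′ f g agree u = refl
    substitution (op k nm es) σ σ′ f g agree u =
      cong (I M k nm) (substitutionV es σ σ′ f g (λ y → agree y ∘ c-op) u)
    substitution (a ≐ b)      σ σ′ f g agree u =
      ≐-cong f g (substitution a σ σ′ f g (λ y → agree y ∘ c-eqˡ) u)
                 (substitution b σ σ′ f g (λ y → agree y ∘ c-eqʳ) u)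
    substitution FALSE        σ σ′ f g agree u = refl
    substitution (a ⇒ b)      σ σ′ f g agree u =
      ⇒-cong f g (substitution a σ σ′ f g (λ y → agree y ∘ c-impˡ) u)
                 (substitution b σ σ′ f g (λ y → agree y ∘ c-impʳ) u)
    substitution (all z a)    σ σ′ f g agree u = ∀-cong f g λ v →
      substitution a _ _ _ _ (binder-agree z a σ σ′ f g v agree) u
    substitution (nabla a)    σ σ′ f g agree u =
      ∇-cong (substitution a σ σ′ f g (λ y → agree y ∘ c-nab))

    substitutionV : ∀ {k} (es : Vec Core k) σ σ′ f g
                  → (∀ y → FreeCV y es → ∀ u → evalC (Mξ f) (lookupSub σ y) u
                                               ≡ evalC (Mξ g) (lookupSub σ′ y) u)
                  → ∀ u → evalV (Mξ f) (substV es σ) u ≡ evalV (Mξ g) (substV es σ′) u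
    substitutionV []       σ σ′ f g agree u = refl
    substitutionV (e ∷ es) σ σ′ f g agree u =
      cong₂ _∷_ (substitution e σ σ′ f g (λ y → agree y ∘ here) u)
                (substitutionV es σ σ′ f g (λ y → agree y ∘ there) u)

  mutual
    rigid-state-independent : ∀ {a} → RigidC a → ∀ f u u′ → evalC (Mξ f) a u ≡ evalC (Mξ f) a u′
    rigid-state-independent r-rvar             f u u′ = refl
    rigid-state-independent (r-op {k} {nm} rs) f u u′ =
      cong (I M k nm) (rigid-state-independentV rs f u u′)
    rigid-state-independent (r-eq ra rb)       f u u′ =
      ≐-cong f f (rigid-state-independent ra f u u′) (rigid-state-independent rb f u u′)
    rigid-state-independent r-F                f u u′ = refl
    rigid-state-independent (r-imp ra rb)      f u u′ =
      ⇒-cong f f (rigid-state-independent ra f u u′) (rigid-state-independent rb f u u′)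
    rigid-state-independent (r-all {z} ra)     f u u′ = ∀-cong f f λ v →
      rigid-state-independent ra (update f z v) u u′

    rigid-state-independentV : ∀ {k} {es : Vec Core k} → RigidV es
                             → ∀ f u u′ → evalV (Mξ f) es u ≡ evalV (Mξ f) es u′
    rigid-state-independentV []       f u u′ = refl
    rigid-state-independentV (r ∷ rs) f u u′ =
      cong₂ _∷_ (rigid-state-independent r f u u′) (rigid-state-independentV rs f u u′)

  application-cong : (d : Definition) (es es′ : Vec Expr (arity d)) (f g : ℕ → U M)
                   → (∀ k u → ⟦ lookup es k ⟧ (Mξ f) u ≡ ⟦ lookup es′ k ⟧ (Mξ g) u)
                   → ∀ u → ⟦ d ⟨ es ⟩ ⟧ (Mξ f) u ≡ ⟦ d ⟨ es′ ⟩ ⟧ (Mξ g) u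
  application-cong d es es′ f g args = substitution (expand (body d)) _ _ f g parameters-agree
    where
      parameters-agree : SubstAgree (expand (body d)) (zipSub (params d) (expandV es))
                                    (zipSub (params d) (expandV es′)) f g
      parameters-agree y fy u
        with zipSub-parameter (params d) y (closed d y (free-expand (body d) fy))
      ... | k , picks = begin
        evalC (Mξ f) (lookupSub (zipSub (params d) (expandV es)) y) u
          ≡⟨ cong (λ c → evalC (Mξ f) c u) (picked es) ⟩
        ⟦ lookup es k ⟧ (Mξ f) u
          ≡⟨ args k u ⟩
        ⟦ lookup es′ k ⟧ (Mξ g) u
          ≡⟨ cong (λ c → evalC (Mξ g) c u) (sym (picked es′)) ⟩
        evalC (Mξ g) (lookupSub (zipSub (params d) (expandV es′)) y) u ∎
        where
          picked : ∀ as → lookupSub (zipSub (params d) (expandV as)) y ≡ expand (lookup as k)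
          picked as = trans (picks (expandV as)) (lookup-expandV as k)

  replace-rigid-argument : ∀ {n} (es : Vec Expr n) i → Rigid (lookup es i) → ∀ x w
    → (∀ j → ¬ FreeIn x (lookup es j))
    → ∀ k u → ⟦ lookup es k ⟧ M u ≡ ⟦ lookup (es [ i ]≔ rvar x) k ⟧ (M [ x ↦ ⟦ lookup es i ⟧ M w ]) u
  replace-rigid-argument es i rigid x w x-fresh k u with k ≟ᶠ i
  ... | yes refl = begin
    ⟦ lookup es k ⟧ M u                           ≡⟨ rigid-state-independent rigid (ξ M) u w ⟩
    v                                             ≡⟨ sym (update-same (ξ M) x v) ⟩
    ⟦ rvar x ⟧ (M [ x ↦ v ]) u                    ≡⟨ cong (λ e → ⟦ e ⟧ (M [ x ↦ v ]) u)
                                                          (sym (lookup∘update k es (rvar x))) ⟩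
    ⟦ lookup (es [ k ]≔ rvar x) k ⟧ (M [ x ↦ v ]) u ∎
    where v = ⟦ lookup es i ⟧ M w
  ... | no k≢i = begin
    ⟦ lookup es k ⟧ M u                           ≡⟨ update-irrelevant (lookup es k) (ξ M) x v (x-fresh k) u ⟩
    ⟦ lookup es k ⟧ (M [ x ↦ v ]) u               ≡⟨ cong (λ e → ⟦ e ⟧ (M [ x ↦ v ]) u)
                                                          (sym (lookup∘update′ k≢i es (rvar x))) ⟩
    ⟦ lookup (es [ i ]≔ rvar x) k ⟧ (M [ x ↦ v ]) u ∎
    where v = ⟦ lookup es i ⟧ M w

lemma1 : (lem : ExcludedMiddle 0ℓ) (d : Definition) (es : Vec Expr (arity d))
         (i : Fin (arity d)) → WFV es → Rigid (lookup es i)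
         → (M : Model) (w : W M) (x : ℕ)
         → (∀ (j : Fin (arity d)) → ¬ FreeIn x (lookup es j))
         → Semantics.⟦_⟧ lem (d ⟨ es ⟩) M w
           ≡ Semantics.⟦_⟧ lem (d ⟨ es [ i ]≔ rvar x ⟩)
               (M [ x ↦ Semantics.⟦_⟧ lem (lookup es i) M w ]) w
lemma1 lem d es i _ rigid M w x x-fresh =
  application-cong d es (es [ i ]≔ rvar x) (ξ M) (update (ξ M) x v)
    (replace-rigid-argument es i rigid x w x-fresh) w
  where
    open ModelSemantics lem M
    v = Semantics.⟦_⟧ lem (lookup es i) M w
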